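{- For every $n\ge 1$, the Bell number $B_n$ (the number of partitions of an $n$-element set) satisfies $$B_n=\sum_{S\subseteq\{1,2,\ldots,n-1\}}\ \prod_{\substack{1\le i\le n\\ e_i\neq 0}}\binom{i-1}{e_i-1},$$ where, for each $S$, $(e_1,\ldots,e_n)=c(S)$ is the code of $S$.
   Context: For $S\subseteq\{1,\ldots,n-1\}$, the code $c(S)=(e_1,\ldots,e_n)\in\mathbb{N}_0^{n}$ is defined recursively by $e_i=0$ if $i\in S$ and $e_i=i-\sum_{j=1}^{i-1}e_j$ if $i\notin S$, for $1\le i\le n$. -}

module Defs where

open import Data.Nat using (ℕ; zero; suc; _+_; _*_; _∸_; _≤_)
open import Data.Nat.Combinatorics using (_C_)
open import Data.Bool using (Bool; true; false; _∧_; if_then_else_; not)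
open import Data.Fin using (Fin)
open import Data.List using (List; []; _∷_; map; concatMap; length; filter; allFin)
open import Data.Vec using (Vec; []; _∷_; lookup; toList)
open import Relation.Nullary.Decidable using (does)
open import Relation.Unary using (Decidable)
open import Data.Bool.Properties using (T?)

infixr 5 _⇒_
_⇒_ : Bool → Bool → Bool
a ⇒ b = not a Data.Bool.∨ b

all : {A : Set} → (A → Bool) → List A → Bool
all p []       = true
all p (x ∷ xs) = p x ∧ all p xs

allBoolVecs : (n : ℕ) → List (Vec Bool n)
allBoolVecs zero    = [] ∷ []
allBoolVecs (suc n) = concatMap (λ v → (false ∷ v) ∷ (true ∷ v) ∷ []) (allBoolVecs n)

allRelations : (n m : ℕ) → List (Vec (Vec Bool n) m)
allRelations n zero    = [] ∷ []
allRelations n (suc m) =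
  concatMap (λ r → map (λ row → row ∷ r) (allBoolVecs n)) (allRelations n m)

-- Set partitions of the n-element set Fin n, represented (as usual) by
-- their equivalence relations: R i j = true iff i, j lie in the same block.

rel : {n : ℕ} → Vec (Vec Bool n) n → Fin n → Fin n → Bool
rel R i j = lookup (lookup R i) j

isEquivalence : {n : ℕ} → Vec (Vec Bool n) n → Bool
isEquivalence {n} R =
  all (λ i → rel R i i) (allFin n) ∧
  all (λ i → all (λ j → rel R i j ⇒ rel R j i) (allFin n)) (allFin n) ∧
  all (λ i → all (λ j → all (λ k → (rel R i j ∧ rel R j k) ⇒ rel R i k)
                             (allFin n)) (allFin n)) (allFin n)

bell : ℕ → ℕ
bell n = length (filter (λ R → T? (isEquivalence R)) (allRelations n n))

-- The code c(S) = (e_1,…,e_n) of S ⊆ {1,…,n-1}.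
-- S is given by its membership list for the indices i, i+1, … ;
-- codeFrom i s ms computes e_i, e_{i+1}, … where s = e_1+⋯+e_{i-1}.

codeFrom : ℕ → ℕ → List Bool → List ℕ
codeFrom i s []         = []
codeFrom i s (b ∷ bs) with b
... | true  = 0 ∷ codeFrom (suc i) s bs
... | false = (i ∸ s) ∷ codeFrom (suc i) (s + (i ∸ s)) bs

-- A subset S ⊆ {1,…,n-1} is a Vec Bool (n ∸ 1) whose k-th entry (k = 0,…)
-- says whether k+1 ∈ S.  The index n is never in S.
membership : (n : ℕ) → Vec Bool (n ∸ 1) → List Bool
membership zero    S = []
membership (suc m) S = toList S Data.List.++ (false ∷ [])

code : (n : ℕ) → Vec Bool (n ∸ 1) → List ℕ
code n S = codeFrom 1 0 (membership n S)

weightFrom : ℕ → List ℕ → ℕ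
weightFrom i []             = 1
weightFrom i (zero  ∷ es)   = weightFrom (suc i) es
weightFrom i (suc e ∷ es)   = ((i ∸ 1) C e) * weightFrom (suc i) es

weight : (n : ℕ) → Vec Bool (n ∸ 1) → ℕ
weight n S = weightFrom 1 (code n S)

{-# OPTIONS --safe #-}
-- Both sides satisfy Bell's recurrence B (m + 1) = Σⱼ C(m, m − j) B j with B 0 = 1.
-- On the right, let 0 = t₀ < t₁ < ⋯ < t_k = n be 0 together with the indices outside S: the code of S
-- is tᵢ − tᵢ₋₁ at tᵢ and 0 elsewhere, so S contributes Πᵢ C(tᵢ − 1, tᵢ − tᵢ₋₁ − 1), and splitting off
-- the last factor gives the recurrence.
-- On the left, a partition of {0, …, n} restricts to one of {1, …, n} in which 0 either forms a new block
-- or joins one of the k blocks. Hence the sum of g (number of blocks) over the partitions of an n-set is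
-- Dⁿ g 0, where D g k = g (k + 1) + k · g k, and the recurrence follows from
-- Dⁿ g (m + 1) = Σₖ C(n, k) Dᵏ (g ∘ suc) m.
module Submission where

open import Defs
open import Data.Bool using (Bool; true; false; _∧_; _∨_; not; if_then_else_)
open import Data.Bool.Properties using (T?; ∧-conicalˡ; ∧-conicalʳ; ¬-not) renaming (_≟_ to _≟ᵇ_)
open import Data.Fin using (Fin; zero; suc)
open import Data.List using (List; []; _∷_; map; concatMap; _++_; filter; length; tabulate; allFin)
open import Data.List.Properties using (map-++; map-∘)
open import Data.Nat using (ℕ; zero; suc; _+_; _*_; _∸_; _≤_; _<_; z<s; s<s)
open import Data.Nat.Combinatorics using (_C_; nCn≡1; nCk+nC[k+1]≡[n+1]C[k+1])
open import Data.Nat.Induction using (<-rec)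
open import Data.Nat.ListAction using (sum)
open import Data.Nat.ListAction.Properties using (sum-++)
open import Data.Nat.Properties
  using (+-identityʳ; +-comm; +-suc; *-zeroʳ; *-identityʳ; *-distribˡ-+; *-comm; m+n∸m≡n)
open import Data.Nat.Tactic.RingSolver using (solve-∀)
open import Data.Product using (∃; _,_)
open import Data.Vec using (Vec; []; _∷_; tail; lookup; replicate; toList)
open import Data.Vec.Properties using (tabulate∘lookup; tabulate-cong; ≡-dec)
open import Function using (_∘_; id; const)
open import Relation.Binary.PropositionalEquality hiding (isEquivalence)
open import Relation.Nullary using (yes; no; contradiction)
open ≡-Reasoning

private variable
  A B : Set
  n : ℕ

∑ : {A : Set} → List A → (A → ℕ) → ℕ
∑ xs f = sum (map f xs)

syntax ∑ xs (λ x → e) = ∑[ x ∈ xs ] e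

∑-cong : ∀ (xs : List A) {f g : A → ℕ} → (∀ x → f x ≡ g x) → ∑ xs f ≡ ∑ xs g
∑-cong []       eq = refl
∑-cong (x ∷ xs) eq = cong₂ _+_ (eq x) (∑-cong xs eq)

∑-+ : ∀ (xs : List A) (f g : A → ℕ) → ∑[ x ∈ xs ] (f x + g x) ≡ ∑ xs f + ∑ xs g
∑-+ []       f g = refl
∑-+ (x ∷ xs) f g = begin
  f x + g x + ∑[ y ∈ xs ] (f y + g y)   ≡⟨ cong (f x + g x +_) (∑-+ xs f g) ⟩
  f x + g x + (∑ xs f + ∑ xs g)         ≡⟨ +-+-interchange (f x) (g x) _ _ ⟩
  f x + ∑ xs f + (g x + ∑ xs g)         ∎
  where
  +-+-interchange : ∀ a b c d → a + b + (c + d) ≡ a + c + (b + d)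
  +-+-interchange = solve-∀

∑-*ˡ : ∀ (xs : List A) c (f : A → ℕ) → ∑[ x ∈ xs ] (c * f x) ≡ c * ∑ xs f
∑-*ˡ []       c f = sym (*-zeroʳ c)
∑-*ˡ (x ∷ xs) c f = trans (cong (c * f x +_) (∑-*ˡ xs c f)) (sym (*-distribˡ-+ c (f x) _))

∑-zero : ∀ (xs : List A) (f : A → ℕ) → (∀ x → f x ≡ 0) → ∑ xs f ≡ 0
∑-zero []       f eq = refl
∑-zero (x ∷ xs) f eq = cong₂ _+_ (eq x) (∑-zero xs f eq)

∑-++ : ∀ (xs ys : List A) (f : A → ℕ) → ∑ (xs ++ ys) f ≡ ∑ xs f + ∑ ys f
∑-++ xs ys f = trans (cong sum (map-++ f xs ys)) (sum-++ (map f xs) (map f ys))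

∑-map : (h : A → B) (xs : List A) (f : B → ℕ) → ∑ (map h xs) f ≡ ∑ xs (f ∘ h)
∑-map h xs f = cong sum (sym (map-∘ {g = f} {f = h} xs))

∑-concatMap : (h : A → List B) (xs : List A) (f : B → ℕ) →
              ∑ (concatMap h xs) f ≡ ∑[ x ∈ xs ] ∑ (h x) f
∑-concatMap h []       f = refl
∑-concatMap h (x ∷ xs) f =
  trans (∑-++ (h x) (concatMap h xs) f) (cong (∑ (h x) f +_) (∑-concatMap h xs f))

∑-comm : (xs : List A) (ys : List B) (f : A → B → ℕ) →
         ∑[ x ∈ xs ] ∑ ys (f x) ≡ ∑[ y ∈ ys ] ∑[ x ∈ xs ] f x y
∑-comm []       ys f = sym (∑-zero ys _ (λ _ → refl))
∑-comm (x ∷ xs) ys f =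
  trans (cong (∑ ys (f x) +_) (∑-comm xs ys f)) (sym (∑-+ ys (f x) _))

length-filter-T? : ∀ (p : A → Bool) (xs : List A) →
                   length (filter (λ x → T? (p x)) xs) ≡ ∑[ x ∈ xs ] (if p x then 1 else 0)
length-filter-T? p []       = refl
length-filter-T? p (x ∷ xs) with p x
... | true  = cong suc (length-filter-T? p xs)
... | false = length-filter-T? p xs

∑-allBoolVecs-suc : ∀ n (f : Vec Bool (suc n) → ℕ) →
  ∑ (allBoolVecs (suc n)) f ≡ ∑[ v ∈ allBoolVecs n ] f (false ∷ v) + ∑[ v ∈ allBoolVecs n ] f (true ∷ v)
∑-allBoolVecs-suc n f = begin
  ∑ (allBoolVecs (suc n)) f                                     ≡⟨ ∑-concatMap _ (allBoolVecs n) f ⟩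
  ∑[ v ∈ allBoolVecs n ] (f (false ∷ v) + (f (true ∷ v) + 0))   ≡⟨ ∑-cong (allBoolVecs n) (λ v → cong (f (false ∷ v) +_) (+-identityʳ _)) ⟩
  ∑[ v ∈ allBoolVecs n ] (f (false ∷ v) + f (true ∷ v))         ≡⟨ ∑-+ (allBoolVecs n) _ _ ⟩
  ∑[ v ∈ allBoolVecs n ] f (false ∷ v) + ∑[ v ∈ allBoolVecs n ] f (true ∷ v) ∎

∑-allBoolVecs-supported : ∀ n (f : Vec Bool n → ℕ) (c : Vec Bool n) →
                          (∀ v → v ≢ c → f v ≡ 0) → ∑ (allBoolVecs n) f ≡ f c
∑-allBoolVecs-supported zero    f []          off = +-identityʳ (f [])
∑-allBoolVecs-supported (suc n) f (false ∷ c) off = begin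
  ∑ (allBoolVecs (suc n)) f                                                  ≡⟨ ∑-allBoolVecs-suc n f ⟩
  ∑[ v ∈ allBoolVecs n ] f (false ∷ v) + ∑[ v ∈ allBoolVecs n ] f (true ∷ v) ≡⟨ cong₂ _+_
    (∑-allBoolVecs-supported n _ c λ v v≢c → off (false ∷ v) (v≢c ∘ cong tail))
    (∑-zero (allBoolVecs n) _ λ v → off (true ∷ v) λ ()) ⟩
  f (false ∷ c) + 0                                                          ≡⟨ +-identityʳ _ ⟩
  f (false ∷ c)                                                              ∎
∑-allBoolVecs-supported (suc n) f (true ∷ c)  off = begin
  ∑ (allBoolVecs (suc n)) f                                                  ≡⟨ ∑-allBoolVecs-suc n f ⟩
  ∑[ v ∈ allBoolVecs n ] f (false ∷ v) + ∑[ v ∈ allBoolVecs n ] f (true ∷ v) ≡⟨ cong₂ _+_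
    (∑-zero (allBoolVecs n) _ λ v → off (false ∷ v) λ ())
    (∑-allBoolVecs-supported n _ c λ v v≢c → off (true ∷ v) (v≢c ∘ cong tail)) ⟩
  f (true ∷ c)                                                               ∎

convolve : ℕ → (ℕ → ℕ) → (ℕ → ℕ) → ℕ
convolve zero    f g = 0
convolve (suc p) f g = f 0 * g p + convolve p (f ∘ suc) g

convolve-cong-< : ∀ p {f f′ : ℕ → ℕ} (g : ℕ → ℕ) → (∀ j → j < p → f j ≡ f′ j) →
                  convolve p f g ≡ convolve p f′ g
convolve-cong-< zero    g eq = refl
convolve-cong-< (suc p) g eq =
  cong₂ _+_ (cong (_* g p) (eq 0 z<s)) (convolve-cong-< p g (λ j j<p → eq (suc j) (s<s j<p)))

convolve-linearˡ : ∀ p (a b : ℕ → ℕ) c g →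
                   convolve p (λ j → a j + c * b j) g ≡ convolve p a g + c * convolve p b g
convolve-linearˡ zero    a b c g = sym (*-zeroʳ c)
convolve-linearˡ (suc p) a b c g =
  trans (cong ((a 0 + c * b 0) * g p +_) (convolve-linearˡ p (a ∘ suc) (b ∘ suc) c g))
        (regroup (a 0) (b 0) c (g p) _ _)
  where
  regroup : ∀ x y c z u v → (x + c * y) * z + (u + c * v) ≡ (x * z + u) + c * (y * z + v)
  regroup = solve-∀

-- Pascal's rule for the second factor: g′ plays the role of (p + 1) C_ when g is p C_.
convolve-pascal : ∀ p (h g g′ : ℕ → ℕ) → g′ 0 ≡ g 0 → (∀ k → g′ (suc k) ≡ g (suc k) + g k) →
                  convolve (suc p) h g′ ≡ convolve (suc p) h g + convolve p h g
convolve-pascal zero    h g g′ g′₀ g′ₛ = trans (cong (λ x → h 0 * x + 0) g′₀) (sym (+-identityʳ _))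
convolve-pascal (suc p) h g g′ g′₀ g′ₛ =
  trans (cong₂ (λ x y → h 0 * x + y) (g′ₛ p) (convolve-pascal p (h ∘ suc) g g′ g′₀ g′ₛ))
        (regroup (h 0) (g (suc p)) (g p) _ _)
  where
  regroup : ∀ h x y u v → h * (x + y) + (u + v) ≡ (h * x + u) + (h * y + v)
  regroup = solve-∀

convolution-recurrence-unique :
  ∀ (K : ℕ → ℕ → ℕ) {f g : ℕ → ℕ} → f 0 ≡ g 0 →
  (∀ m → f (suc m) ≡ convolve (suc m) f (K m)) → (∀ m → g (suc m) ≡ convolve (suc m) g (K m)) →
  ∀ k → f k ≡ g k
convolution-recurrence-unique K {f} {g} f₀≡g₀ f-rec g-rec = <-rec _ step
  where
  step : ∀ k → (∀ {j} → j < k → f j ≡ g j) → f k ≡ g k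
  step zero    _  = f₀≡g₀
  step (suc m) ih = begin
    f (suc m)                  ≡⟨ f-rec m ⟩
    convolve (suc m) f (K m)   ≡⟨ convolve-cong-< (suc m) (K m) (λ j → ih) ⟩
    convolve (suc m) g (K m)   ≡⟨ g-rec m ⟨
    g (suc m)                  ∎

binomialTransform : ℕ → (ℕ → ℕ) → ℕ
binomialTransform zero    f = f 0
binomialTransform (suc n) f = binomialTransform n f + binomialTransform n (f ∘ suc)

binomialTransform-cong : ∀ n {f f′ : ℕ → ℕ} → (∀ k → f k ≡ f′ k) →
                         binomialTransform n f ≡ binomialTransform n f′
binomialTransform-cong zero    eq = eq 0
binomialTransform-cong (suc n) eq =
  cong₂ _+_ (binomialTransform-cong n eq) (binomialTransform-cong n (eq ∘ suc))

binomialTransform-linear : ∀ n (a b : ℕ → ℕ) c →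
  binomialTransform n (λ k → a k + c * b k) ≡ binomialTransform n a + c * binomialTransform n b
binomialTransform-linear zero    a b c = refl
binomialTransform-linear (suc n) a b c =
  trans (cong₂ _+_ (binomialTransform-linear n a b c) (binomialTransform-linear n (a ∘ suc) (b ∘ suc) c))
        (regroup c (binomialTransform n a) (binomialTransform n b) _ _)
  where
  regroup : ∀ c x y u v → (x + c * y) + (u + c * v) ≡ (x + u) + c * (y + v)
  regroup = solve-∀

binomialTransform≡convolve : ∀ n f → binomialTransform n f ≡ convolve (suc n) f (n C_)
binomialTransform≡convolve zero    f = sym (trans (+-identityʳ _) (*-identityʳ (f 0)))
binomialTransform≡convolve (suc n) f = begin
  binomialTransform n f + binomialTransform n (f ∘ suc)
    ≡⟨ cong₂ _+_ (binomialTransform≡convolve n f) (binomialTransform≡convolve n (f ∘ suc)) ⟩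
  f 0 * (n C n) + convolve n (f ∘ suc) (n C_) + convolve (suc n) (f ∘ suc) (n C_)
    ≡⟨ regroup (f 0 * (n C n)) _ _ ⟩
  f 0 * (n C n) + (convolve (suc n) (f ∘ suc) (n C_) + convolve n (f ∘ suc) (n C_))
    ≡⟨ cong₂ (λ x y → f 0 * x + y) (trans (nCn≡1 n) (sym (nCn≡1 (suc n))))
             (sym (convolve-pascal n (f ∘ suc) (n C_) (suc n C_) refl pascal)) ⟩
  f 0 * (suc n C suc n) + convolve (suc n) (f ∘ suc) (suc n C_)
    ∎
  where
  regroup : ∀ x y z → x + y + z ≡ x + (z + y)
  regroup = solve-∀
  pascal : ∀ k → suc n C suc k ≡ n C suc k + n C k
  pascal k = trans (sym (nCk+nC[k+1]≡[n+1]C[k+1] n k)) (+-comm (n C k) _)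

-- A new point opens a block or joins one of the k existing ones.
D : (ℕ → ℕ) → ℕ → ℕ
D g k = g (suc k) + k * g k

Dⁿ : ℕ → (ℕ → ℕ) → ℕ → ℕ
Dⁿ zero    g = g
Dⁿ (suc n) g = Dⁿ n (D g)

Dⁿ-suc : ∀ n g m → Dⁿ (suc n) g m ≡ D (Dⁿ n g) m
Dⁿ-suc zero    g m = refl
Dⁿ-suc (suc n) g m = Dⁿ-suc n (D g) m

Dⁿ-shift : ∀ n m g → Dⁿ n g (suc m) ≡ binomialTransform n (λ k → Dⁿ k (g ∘ suc) m)
Dⁿ-shift zero    m g = refl
Dⁿ-shift (suc n) m g = begin
  Dⁿ (suc n) g (suc m)                                   ≡⟨ Dⁿ-suc n g (suc m) ⟩
  Dⁿ n g (suc (suc m)) + suc m * Dⁿ n g (suc m)          ≡⟨ cong₂ (λ x y → x + suc m * y) (Dⁿ-shift n (suc m) g) (Dⁿ-shift n m g) ⟩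
  binomialTransform n Fₘ₊₁ + suc m * binomialTransform n Fₘ  ≡⟨ regroup m (binomialTransform n Fₘ) _ ⟩
  binomialTransform n Fₘ + (binomialTransform n Fₘ₊₁ + m * binomialTransform n Fₘ)
    ≡⟨ cong (binomialTransform n Fₘ +_) (sym (binomialTransform-linear n Fₘ₊₁ Fₘ m)) ⟩
  binomialTransform n Fₘ + binomialTransform n (λ k → Fₘ₊₁ k + m * Fₘ k)
    ≡⟨ cong (binomialTransform n Fₘ +_) (binomialTransform-cong n (λ k → sym (Dⁿ-suc k (g ∘ suc) m))) ⟩
  binomialTransform (suc n) Fₘ                            ∎
  where
  Fₘ Fₘ₊₁ : ℕ → ℕ
  Fₘ k = Dⁿ k (g ∘ suc) m
  Fₘ₊₁ k = Dⁿ k (g ∘ suc) (suc m)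
  regroup : ∀ m a b → b + suc m * a ≡ a + (b + m * a)
  regroup = solve-∀

bellᴰ : ℕ → ℕ
bellᴰ n = Dⁿ n (const 1) 0

bellᴰ-recurrence : ∀ m → bellᴰ (suc m) ≡ convolve (suc m) bellᴰ (m C_)
bellᴰ-recurrence m = begin
  Dⁿ (suc m) (const 1) 0        ≡⟨ Dⁿ-suc m (const 1) 0 ⟩
  Dⁿ m (const 1) 1 + 0          ≡⟨ +-identityʳ _ ⟩
  Dⁿ m (const 1) 1              ≡⟨ Dⁿ-shift m 0 (const 1) ⟩
  binomialTransform m bellᴰ     ≡⟨ binomialTransform≡convolve m bellᴰ ⟩
  convolve (suc m) bellᴰ (m C_) ∎

codeWeightFrom : ℕ → ℕ → ℕ → ℕ
codeWeightFrom i s m = ∑[ v ∈ allBoolVecs m ] weightFrom i (codeFrom i s (toList v ++ false ∷ []))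

-- The codes continued at index i = s + d + 1 with e₁ + ⋯ + eᵢ₋₁ = s, i.e. the d indices before i lie
-- in S; the m memberships of i, …, i + m − 1 are free and the last index i + m is outside S.
codeWeightSum : ℕ → ℕ → ℕ → ℕ
codeWeightSum s d = codeWeightFrom (suc (s + d)) s

weightFrom-codeFrom-false : ∀ s d bs →
  weightFrom (suc (s + d)) (codeFrom (suc (s + d)) s (false ∷ bs)) ≡
  ((s + d) C d) * weightFrom (suc (suc (s + d))) (codeFrom (suc (suc (s + d))) (suc (s + d)) bs)
weightFrom-codeFrom-false s d bs
  rewrite trans (cong (_∸ s) (sym (+-suc s d))) (m+n∸m≡n s (suc d)) | +-suc s d = refl

codeWeightSum-zero : ∀ s d → codeWeightSum s d 0 ≡ (s + d) C d
codeWeightSum-zero s d = trans (+-identityʳ _) (trans (weightFrom-codeFrom-false s d []) (*-identityʳ _))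

codeWeightSum-suc : ∀ s d m →
  codeWeightSum s d (suc m) ≡ codeWeightSum s (suc d) m + ((s + d) C d) * codeWeightSum (suc (s + d)) 0 m
codeWeightSum-suc s d m = begin
  codeWeightSum s d (suc m)
    ≡⟨ ∑-allBoolVecs-suc m _ ⟩
  ∑[ v ∈ allBoolVecs m ] w (false ∷ v) + ∑[ v ∈ allBoolVecs m ] w (true ∷ v)
    ≡⟨ +-comm (∑[ v ∈ allBoolVecs m ] w (false ∷ v)) _ ⟩
  ∑[ v ∈ allBoolVecs m ] w (true ∷ v) + ∑[ v ∈ allBoolVecs m ] w (false ∷ v)
    ≡⟨ cong₂ _+_ (cong (λ x → codeWeightFrom (suc x) s m) (sym (+-suc s d)))
                 (∑-cong (allBoolVecs m) (λ v → weightFrom-codeFrom-false s d (toList v ++ false ∷ []))) ⟩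
  codeWeightSum s (suc d) m + ∑[ v ∈ allBoolVecs m ] (((s + d) C d) * w′ v)
    ≡⟨ cong (codeWeightSum s (suc d) m +_) (∑-*ˡ (allBoolVecs m) ((s + d) C d) w′) ⟩
  codeWeightSum s (suc d) m + ((s + d) C d) * codeWeightFrom (suc (suc (s + d))) (suc (s + d)) m
    ≡⟨ cong (λ x → codeWeightSum s (suc d) m + ((s + d) C d) * codeWeightFrom (suc x) (suc (s + d)) m)
            (sym (+-identityʳ (suc (s + d)))) ⟩
  codeWeightSum s (suc d) m + ((s + d) C d) * codeWeightSum (suc (s + d)) 0 m
    ∎
  where
  w : Vec Bool (suc m) → ℕ
  w v = weightFrom (suc (s + d)) (codeFrom (suc (s + d)) s (toList v ++ false ∷ []))
  w′ : Vec Bool m → ℕ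
  w′ v = weightFrom (suc (suc (s + d))) (codeFrom (suc (suc (s + d))) (suc (s + d)) (toList v ++ false ∷ []))

-- Split at the last index outside S before the final one: it is s (first summand) or s + d + 1 + j.
codeWeightSum-lastBlock : ∀ m s d →
  codeWeightSum s d m ≡ (s + d + m) C (d + m) + convolve m (codeWeightSum s d) ((s + d + m) C_)
codeWeightSum-lastBlock zero    s d =
  trans (codeWeightSum-zero s d) (sym (trans (+-identityʳ _) (cong₂ _C_ (+-identityʳ (s + d)) (+-identityʳ d))))
codeWeightSum-lastBlock (suc m) s d = begin
  W s d (suc m)
    ≡⟨ codeWeightSum-suc s d m ⟩
  W s (suc d) m + c * W (suc (s + d)) 0 m
    ≡⟨ cong₂ (λ x y → x + c * y) (codeWeightSum-lastBlock m s (suc d)) (codeWeightSum-lastBlock m (suc (s + d)) 0) ⟩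
  (s + suc d + m) C (suc d + m) + convolve m (W s (suc d)) ((s + suc d + m) C_)
    + c * ((suc (s + d) + 0 + m) C m + convolve m (W (suc (s + d)) 0) ((suc (s + d) + 0 + m) C_))
    ≡⟨ cong₂ (λ x y → x C (suc d + m) + convolve m (W s (suc d)) (x C_)
                      + c * (y C m + convolve m (W (suc (s + d)) 0) (y C_))) N₁ N₂ ⟩
  N C (suc d + m) + convolve m (W s (suc d)) (N C_) + c * (N C m + convolve m (W (suc (s + d)) 0) (N C_))
    ≡⟨ regroup (N C (suc d + m)) _ c _ _ ⟩
  N C (suc d + m) + (c * (N C m) + (convolve m (W s (suc d)) (N C_) + c * convolve m (W (suc (s + d)) 0) (N C_)))
    ≡⟨ cong₂ (λ k x → N C k + (c * (N C m) + x)) (sym (+-suc d m))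
             (sym (convolve-linearˡ m (W s (suc d)) (W (suc (s + d)) 0) c (N C_))) ⟩
  N C (d + suc m) + (c * (N C m) + convolve m (λ j → W s (suc d) j + c * W (suc (s + d)) 0 j) (N C_))
    ≡⟨ cong₂ (λ x y → N C (d + suc m) + (x * (N C m) + y)) (sym (codeWeightSum-zero s d))
             (convolve-cong-< m (N C_) (λ j _ → sym (codeWeightSum-suc s d j))) ⟩
  N C (d + suc m) + convolve (suc m) (W s d) (N C_)
    ∎
  where
  W : ℕ → ℕ → ℕ → ℕ
  W = codeWeightSum
  c N : ℕ
  c = (s + d) C d
  N = s + d + suc m
  N₁ : s + suc d + m ≡ N
  N₁ = trans (cong (_+ m) (+-suc s d)) (sym (+-suc (s + d) m))
  N₂ : suc (s + d) + 0 + m ≡ N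
  N₂ = trans (cong (λ x → suc x + m) (+-identityʳ (s + d))) (sym (+-suc (s + d) m))
  regroup : ∀ a b c x y → a + b + c * (x + y) ≡ a + (c * x + (b + c * y))
  regroup = solve-∀

codeSum : ℕ → ℕ
codeSum zero    = 1
codeSum (suc m) = codeWeightSum 0 0 m

codeSum-recurrence : ∀ m → codeSum (suc m) ≡ convolve (suc m) codeSum (m C_)
codeSum-recurrence m =
  trans (codeWeightSum-lastBlock m 0 0) (cong (_+ convolve m (codeWeightSum 0 0) (m C_)) (sym (+-identityʳ _)))

⇒-elim : ∀ {a b} → (a ⇒ b) ≡ true → a ≡ true → b ≡ true
⇒-elim {true} a⇒b refl = a⇒b

⇒-intro : ∀ {a b} → (a ≡ true → b ≡ true) → (a ⇒ b) ≡ true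
⇒-intro {true}  f = f refl
⇒-intro {false} f = refl

bool-ext : ∀ {a b} → (a ≡ true → b ≡ true) → (b ≡ true → a ≡ true) → a ≡ b
bool-ext {true}          f g = sym (f refl)
bool-ext {false} {true}  f g = g refl
bool-ext {false} {false} f g = refl

_≡ᵇ_ : Bool → Bool → Bool
true  ≡ᵇ b = b
false ≡ᵇ b = not b

≡ᵇ⇒≡ : ∀ {a b} → (a ≡ᵇ b) ≡ true → a ≡ b
≡ᵇ⇒≡ {true}          eq = sym eq
≡ᵇ⇒≡ {false} {false} eq = refl

≡⇒≡ᵇ : ∀ {a b} → a ≡ b → (a ≡ᵇ b) ≡ true
≡⇒≡ᵇ {true}  refl = refl
≡⇒≡ᵇ {false} refl = refl

all-tabulate⇒ : ∀ (p : A → Bool) (f : Fin n → A) → all p (tabulate f) ≡ true → ∀ i → p (f i) ≡ true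
all-tabulate⇒ p f eq zero    = ∧-conicalˡ _ _ eq
all-tabulate⇒ p f eq (suc i) = all-tabulate⇒ p (f ∘ suc) (∧-conicalʳ (p (f zero)) _ eq) i

all-tabulate⇐ : ∀ (p : A → Bool) (f : Fin n → A) → (∀ i → p (f i) ≡ true) → all p (tabulate f) ≡ true
all-tabulate⇐ {n = zero}  p f h = refl
all-tabulate⇐ {n = suc n} p f h = cong₂ _∧_ (h zero) (all-tabulate⇐ p (f ∘ suc) (h ∘ suc))

lookup-ext : ∀ (u v : Vec A n) → (∀ i → lookup u i ≡ lookup v i) → u ≡ v
lookup-ext u v eq = trans (sym (tabulate∘lookup u)) (trans (tabulate-cong eq) (tabulate∘lookup v))

BoolRel : ℕ → Set
BoolRel n = Fin n → Fin n → Bool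

record IsEquivalenceᵇ (r : BoolRel n) : Set where
  field
    reflexive  : ∀ i → r i i ≡ true
    symmetric  : ∀ i j → r i j ≡ true → r j i ≡ true
    transitive : ∀ i j k → r i j ≡ true → r j k ≡ true → r i k ≡ true
open IsEquivalenceᵇ

isEquivalence-sound : ∀ (R : Vec (Vec Bool n) n) → isEquivalence R ≡ true → IsEquivalenceᵇ (rel R)
isEquivalence-sound {n} R eq = record
  { reflexive  = all-tabulate⇒ _ id (∧-conicalˡ _ _ eq)
  ; symmetric  = λ i j → ⇒-elim (all-tabulate⇒ _ id (all-tabulate⇒ _ id symᵇ i) j)
  ; transitive = λ i j k Rij Rjk →
      ⇒-elim (all-tabulate⇒ _ id (all-tabulate⇒ _ id (all-tabulate⇒ _ id transᵇ i) j) k) (cong₂ _∧_ Rij Rjk)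
  }
  where
  symᵇ : all (λ i → all (λ j → rel R i j ⇒ rel R j i) (allFin n)) (allFin n) ≡ true
  symᵇ = ∧-conicalˡ _ _ (∧-conicalʳ (all (λ i → rel R i i) (allFin n)) _ eq)
  transᵇ : all (λ i → all (λ j → all (λ k → (rel R i j ∧ rel R j k) ⇒ rel R i k)
                                      (allFin n)) (allFin n)) (allFin n) ≡ true
  transᵇ = ∧-conicalʳ _ _ (∧-conicalʳ (all (λ i → rel R i i) (allFin n)) _ eq)

isEquivalence-complete : ∀ (R : Vec (Vec Bool n) n) → IsEquivalenceᵇ (rel R) → isEquivalence R ≡ true
isEquivalence-complete R E = cong₂ _∧_ (all-tabulate⇐ _ id (reflexive E)) (cong₂ _∧_
  (all-tabulate⇐ _ id λ i → all-tabulate⇐ _ id λ j → ⇒-intro (symmetric E i j))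
  (all-tabulate⇐ _ id λ i → all-tabulate⇐ _ id λ j → all-tabulate⇐ _ id λ k → ⇒-intro λ Rijk →
     transitive E i j k (∧-conicalˡ _ _ Rijk) (∧-conicalʳ (rel R i j) _ Rijk)))

IsEquivalenceᵇ-cong : ∀ {r r′ : BoolRel n} → (∀ i j → r i j ≡ r′ i j) → IsEquivalenceᵇ r → IsEquivalenceᵇ r′
IsEquivalenceᵇ-cong r≗r′ E = record
  { reflexive  = λ i → trans (sym (r≗r′ i i)) (reflexive E i)
  ; symmetric  = λ i j p → trans (sym (r≗r′ j i)) (symmetric E i j (trans (r≗r′ i j) p))
  ; transitive = λ i j k p q →
      trans (sym (r≗r′ i k)) (transitive E i j k (trans (r≗r′ i j) p) (trans (r≗r′ j k) q))
  }

-- For an equivalence r, the closed c are ∅ and the classes of r, so blocks = nonempty closed sets.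
Closed : BoolRel n → (Fin n → Bool) → Set
Closed r c = ∀ j k → c j ≡ true → r j k ≡ c k

Closed-cong : ∀ {r r′ : BoolRel n} {c : Fin n → Bool} → (∀ i j → r i j ≡ r′ i j) → Closed r c → Closed r′ c
Closed-cong r≗r′ closed j k cj = trans (sym (r≗r′ j k)) (closed j k cj)

Closed-meet : ∀ {r : BoolRel n} {c d : Fin n → Bool} → Closed r c → Closed r d →
              ∀ j → c j ≡ true → d j ≡ true → ∀ k → d k ≡ c k
Closed-meet Cc Cd j cj dj k = trans (sym (Cd j k dj)) (Cc j k cj)

closedᵇ : Vec (Vec Bool n) n → Vec Bool n → Bool
closedᵇ {n} R c = all (λ j → all (λ k → lookup c j ⇒ (rel R j k ≡ᵇ lookup c k)) (allFin n)) (allFin n)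

closedᵇ-sound : ∀ R (c : Vec Bool n) → closedᵇ R c ≡ true → Closed (rel R) (lookup c)
closedᵇ-sound R c eq j k cj = ≡ᵇ⇒≡ (⇒-elim (all-tabulate⇒ _ id (all-tabulate⇒ _ id eq j) k) cj)

closedᵇ-complete : ∀ R (c : Vec Bool n) → Closed (rel R) (lookup c) → closedᵇ R c ≡ true
closedᵇ-complete R c closed = all-tabulate⇐ _ id λ j → all-tabulate⇐ _ id λ k → ⇒-intro (≡⇒≡ᵇ ∘ closed j k)

bordered : Bool → (Fin n → Bool) → (Fin n → Bool) → BoolRel n → BoolRel (suc n)
bordered b v c r zero    zero    = b
bordered b v c r zero    (suc k) = v k
bordered b v c r (suc j) zero    = c j
bordered b v c r (suc j) (suc k) = r j k

module _ {b : Bool} {v c : Fin n → Bool} {r : BoolRel n} (E : IsEquivalenceᵇ (bordered b v c r)) where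

  bordered-corner : b ≡ true
  bordered-corner = reflexive E zero

  bordered-row≗column : ∀ k → v k ≡ c k
  bordered-row≗column k = bool-ext (symmetric E zero (suc k)) (symmetric E (suc k) zero)

  bordered-inner : IsEquivalenceᵇ r
  bordered-inner = record
    { reflexive  = reflexive E ∘ suc
    ; symmetric  = λ i j → symmetric E (suc i) (suc j)
    ; transitive = λ i j k → transitive E (suc i) (suc j) (suc k)
    }

  bordered-closed : Closed r c
  bordered-closed j k cj = bool-ext
    (λ rjk → transitive E (suc k) (suc j) zero (symmetric E (suc j) (suc k) rjk) cj)
    (λ ck  → transitive E (suc j) zero (suc k) cj (symmetric E (suc k) zero ck))

bordered-isEquivalence : ∀ {c : Fin n → Bool} {r : BoolRel n} →
                         IsEquivalenceᵇ r → Closed r c → IsEquivalenceᵇ (bordered true c c r)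
bordered-isEquivalence {n} {c} {r} E closed = record { reflexive = refl′ ; symmetric = sym′ ; transitive = trans′ }
  where
  r⁺ : BoolRel (suc n)
  r⁺ = bordered true c c r
  refl′ : ∀ i → r⁺ i i ≡ true
  refl′ zero    = refl
  refl′ (suc i) = reflexive E i
  sym′ : ∀ i j → r⁺ i j ≡ true → r⁺ j i ≡ true
  sym′ zero    zero    p = p
  sym′ zero    (suc k) p = p
  sym′ (suc j) zero    p = p
  sym′ (suc i) (suc j) p = symmetric E i j p
  trans′ : ∀ i j k → r⁺ i j ≡ true → r⁺ j k ≡ true → r⁺ i k ≡ true
  trans′ zero    zero    k       p q = q
  trans′ zero    (suc j) zero    p q = refl
  trans′ zero    (suc j) (suc k) p q = trans (sym (closed j k p)) q
  trans′ (suc i) zero    zero    p q = p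
  trans′ (suc i) zero    (suc k) p q = trans (closed i k p) q
  trans′ (suc i) (suc j) zero    p q = trans (sym (closed j i q)) (symmetric E i j p)
  trans′ (suc i) (suc j) (suc k) p q = transitive E i j k p q

module _ (c : Vec Bool n) {d : Vec Bool n} {r : BoolRel n} where

  private
    r⁺ : BoolRel (suc n)
    r⁺ = bordered true (lookup c) (lookup c) r

  extension-closed-new⇒ : Closed r⁺ (lookup (true ∷ d)) → d ≡ c
  extension-closed-new⇒ closed = lookup-ext d c (λ k → sym (closed zero (suc k) refl))

  extension-closed-old⇒closed : Closed r⁺ (lookup (false ∷ d)) → Closed r (lookup d)
  extension-closed-old⇒closed closed j k = closed (suc j) (suc k)

  extension-closed-old⇒disjoint : Closed r⁺ (lookup (false ∷ d)) → ∀ j → lookup d j ≡ true → lookup c j ≡ false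
  extension-closed-old⇒disjoint closed j = closed (suc j) zero

  extension-closed-old⇐ : Closed r (lookup d) → (∀ j → lookup d j ≡ true → lookup c j ≡ false) →
                          Closed r⁺ (lookup (false ∷ d))
  extension-closed-old⇐ closed disjoint (suc j) zero    dj = disjoint j dj
  extension-closed-old⇐ closed disjoint (suc j) (suc k) dj = closed j k dj

extension-closed-new⇐ : ∀ (c : Vec Bool n) {r : BoolRel n} →
                        Closed r (lookup c) → Closed (bordered true (lookup c) (lookup c) r) (lookup (true ∷ c))
extension-closed-new⇐ c closed zero    zero    _  = refl
extension-closed-new⇐ c closed zero    (suc k) _  = refl
extension-closed-new⇐ c closed (suc j) zero    cj = cj
extension-closed-new⇐ c closed (suc j) (suc k) cj = closed j k cj

prependColumn : ∀ {m} → Vec Bool m → Vec (Vec Bool n) m → Vec (Vec Bool (suc n)) m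
prependColumn []      []      = []
prependColumn (b ∷ c) (v ∷ R) = (b ∷ v) ∷ prependColumn c R

lookup-prependColumn : ∀ {m} (c : Vec Bool m) (R : Vec (Vec Bool n) m) i →
                       lookup (prependColumn c R) i ≡ lookup c i ∷ lookup R i
lookup-prependColumn (b ∷ c) (v ∷ R) zero    = refl
lookup-prependColumn (b ∷ c) (v ∷ R) (suc i) = lookup-prependColumn c R i

rel-bordered : ∀ b (v c : Vec Bool n) R i j →
               rel ((b ∷ v) ∷ prependColumn c R) i j ≡ bordered b (lookup v) (lookup c) (rel R) i j
rel-bordered b v c R zero    zero    = refl
rel-bordered b v c R zero    (suc j) = refl
rel-bordered b v c R (suc i) zero    rewrite lookup-prependColumn c R i = refl
rel-bordered b v c R (suc i) (suc j) rewrite lookup-prependColumn c R i = refl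

-- The new element 0 joins the block c of R, or forms a singleton block when c is empty.
extend : Vec Bool n → Vec (Vec Bool n) n → Vec (Vec Bool (suc n)) (suc n)
extend c R = (true ∷ c) ∷ prependColumn c R

isEquivalence-extend : ∀ (c : Vec Bool n) R → isEquivalence (extend c R) ≡ isEquivalence R ∧ closedᵇ R c
isEquivalence-extend c R = bool-ext
  (λ eq → let E = IsEquivalenceᵇ-cong (rel-bordered true c c R) (isEquivalence-sound (extend c R) eq) in
    cong₂ _∧_ (isEquivalence-complete R (bordered-inner E)) (closedᵇ-complete R c (bordered-closed E)))
  (λ eq → isEquivalence-complete (extend c R) (IsEquivalenceᵇ-cong (λ i j → sym (rel-bordered true c c R i j))
    (bordered-isEquivalence (isEquivalence-sound R (∧-conicalˡ _ _ eq))
                            (closedᵇ-sound R c (∧-conicalʳ (isEquivalence R) _ eq)))))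

nonempty : Vec Bool n → Bool
nonempty []      = false
nonempty (b ∷ v) = b ∨ nonempty v

nonempty-false⇒ : ∀ (v : Vec Bool n) → nonempty v ≡ false → ∀ i → lookup v i ≡ false
nonempty-false⇒ (false ∷ v) eq zero    = refl
nonempty-false⇒ (false ∷ v) eq (suc i) = nonempty-false⇒ v eq i

nonempty-false⇒≡replicate : ∀ (v : Vec Bool n) → nonempty v ≡ false → v ≡ replicate n false
nonempty-false⇒≡replicate []          eq = refl
nonempty-false⇒≡replicate (false ∷ v) eq = cong (false ∷_) (nonempty-false⇒≡replicate v eq)

nonempty-replicate : ∀ n → nonempty (replicate n false) ≡ false
nonempty-replicate zero    = refl
nonempty-replicate (suc n) = nonempty-replicate n

nonempty-true⇒ : ∀ (v : Vec Bool n) → nonempty v ≡ true → ∃ λ i → lookup v i ≡ true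
nonempty-true⇒ (true  ∷ v) eq = zero , refl
nonempty-true⇒ (false ∷ v) eq with nonempty-true⇒ v eq
... | i , vi = suc i , vi

isBlock : Vec (Vec Bool n) n → Vec Bool n → ℕ
isBlock R d = if closedᵇ R d ∧ nonempty d then 1 else 0

blockCount : Vec (Vec Bool n) n → ℕ
blockCount {n} R = ∑ (allBoolVecs n) (isBlock R)

module _ (c : Vec Bool n) (R : Vec (Vec Bool n) n) where

  closedᵇ-extend⇒ : ∀ b d → closedᵇ (extend c R) (b ∷ d) ≡ true →
                    Closed (bordered true (lookup c) (lookup c) (rel R)) (lookup (b ∷ d))
  closedᵇ-extend⇒ b d eq = Closed-cong (rel-bordered true c c R) (closedᵇ-sound (extend c R) (b ∷ d) eq)

  closedᵇ-extend⇐ : ∀ b d → Closed (bordered true (lookup c) (lookup c) (rel R)) (lookup (b ∷ d)) →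
                    closedᵇ (extend c R) (b ∷ d) ≡ true
  closedᵇ-extend⇐ b d closed =
    closedᵇ-complete (extend c R) (b ∷ d) (Closed-cong (λ i j → sym (rel-bordered true c c R i j)) closed)

  isBlock-extend-new-self : Closed (rel R) (lookup c) → isBlock (extend c R) (true ∷ c) ≡ 1
  isBlock-extend-new-self closed rewrite closedᵇ-extend⇐ true c (extension-closed-new⇐ c closed) = refl

  isBlock-extend-new-other : ∀ d → d ≢ c → isBlock (extend c R) (true ∷ d) ≡ 0
  isBlock-extend-new-other d d≢c with closedᵇ (extend c R) (true ∷ d) in eq
  ... | true  = contradiction (extension-closed-new⇒ c (closedᵇ-extend⇒ true d eq)) d≢c
  ... | false = refl

  isBlock-extend-old-self : ∀ j → lookup c j ≡ true → isBlock (extend c R) (false ∷ c) ≡ 0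
  isBlock-extend-old-self j cj with closedᵇ (extend c R) (false ∷ c) in eq
  ... | true  = contradiction (trans (sym cj) (extension-closed-old⇒disjoint c (closedᵇ-extend⇒ false c eq) j cj)) λ ()
  ... | false = refl

  isBlock-extend-old-disjoint : ∀ d → (Closed (rel R) (lookup d) → ∀ j → lookup d j ≡ true → lookup c j ≡ false) →
                                isBlock (extend c R) (false ∷ d) ≡ isBlock R d
  isBlock-extend-old-disjoint d disjoint = cong (λ b → if b ∧ nonempty d then 1 else 0) (bool-ext
    (λ eq → closedᵇ-complete R d (extension-closed-old⇒closed c (closedᵇ-extend⇒ false d eq)))
    (λ eq → let Cd = closedᵇ-sound R d eq in closedᵇ-extend⇐ false d (extension-closed-old⇐ c Cd (disjoint Cd))))

blockCount-extend : ∀ (c : Vec Bool n) R → Closed (rel R) (lookup c) → ∀ {b} → nonempty c ≡ b →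
                    blockCount (extend c R) ≡ (if b then blockCount R else suc (blockCount R))
blockCount-extend {n} c R Cc {b} c-nonempty = trans (∑-allBoolVecs-suc n _) (by-cases b c-nonempty)
  where
  old new : Vec Bool n → ℕ
  old d = isBlock (extend c R) (false ∷ d)
  new d = isBlock (extend c R) (true ∷ d)

  ∑new : ∑ (allBoolVecs n) new ≡ 1
  ∑new = trans (∑-allBoolVecs-supported n new c (isBlock-extend-new-other c R)) (isBlock-extend-new-self c R Cc)

  by-cases : ∀ b → nonempty c ≡ b →
             ∑ (allBoolVecs n) old + ∑ (allBoolVecs n) new ≡ (if b then blockCount R else suc (blockCount R))
  by-cases false c-empty = trans
    (cong₂ _+_ (∑-cong (allBoolVecs n) λ d → isBlock-extend-old-disjoint c R d λ _ j _ → nonempty-false⇒ c c-empty j) ∑new)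
    (+-comm (blockCount R) 1)
  by-cases true c-nonempty with nonempty-true⇒ c c-nonempty
  ... | j , cj = trans (sym (∑-+ (allBoolVecs n) old new)) (∑-cong (allBoolVecs n) old+new)
    where
    isBlock-c : isBlock R c ≡ 1
    isBlock-c rewrite closedᵇ-complete R c Cc | c-nonempty = refl
    old+new : ∀ d → old d + new d ≡ isBlock R d
    old+new d with ≡-dec _≟ᵇ_ d c
    ... | yes refl = trans (cong₂ _+_ (isBlock-extend-old-self c R j cj) (isBlock-extend-new-self c R Cc)) (sym isBlock-c)
    ... | no d≢c   = trans (cong (old d +_) (isBlock-extend-new-other c R d d≢c)) (trans (+-identityʳ (old d))
      (isBlock-extend-old-disjoint c R d λ Cd i di → ¬-not λ ci → d≢c (lookup-ext d c (Closed-meet Cc Cd i ci di))))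

∑-allRelations-suc : ∀ n m (F : Vec (Vec Bool n) (suc m) → ℕ) →
  ∑ (allRelations n (suc m)) F ≡ ∑[ rows ∈ allRelations n m ] ∑[ row ∈ allBoolVecs n ] F (row ∷ rows)
∑-allRelations-suc n m F = trans (∑-concatMap _ (allRelations n m) F)
                                 (∑-cong (allRelations n m) (λ rows → ∑-map (_∷ rows) (allBoolVecs n) F))

∑-allRelations-byFirstColumn : ∀ n m (F : Vec (Vec Bool (suc n)) m → ℕ) →
  ∑ (allRelations (suc n) m) F ≡ ∑[ c ∈ allBoolVecs m ] ∑[ R ∈ allRelations n m ] F (prependColumn c R)
∑-allRelations-byFirstColumn n zero    F = cong (_+ 0) (sym (+-identityʳ (F [])))
∑-allRelations-byFirstColumn n (suc m) F = begin
  ∑ (allRelations (suc n) (suc m)) F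
    ≡⟨ ∑-allRelations-suc (suc n) m F ⟩
  ∑[ rows ∈ allRelations (suc n) m ] ∑[ row ∈ allBoolVecs (suc n) ] F (row ∷ rows)
    ≡⟨ ∑-allRelations-byFirstColumn n m _ ⟩
  ∑[ c ∈ allBoolVecs m ] ∑[ R ∈ allRelations n m ] ∑[ row ∈ allBoolVecs (suc n) ] F (row ∷ prependColumn c R)
    ≡⟨ ∑-cong (allBoolVecs m) (λ c → trans (∑-cong (allRelations n m) (λ R → ∑-allBoolVecs-suc n _))
                                           (∑-+ (allRelations n m) _ _)) ⟩
  ∑[ c ∈ allBoolVecs m ] (G (false ∷ c) + G (true ∷ c))
    ≡⟨ ∑-+ (allBoolVecs m) _ _ ⟩
  ∑[ c ∈ allBoolVecs m ] G (false ∷ c) + ∑[ c ∈ allBoolVecs m ] G (true ∷ c)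
    ≡⟨ ∑-allBoolVecs-suc m G ⟨
  ∑ (allBoolVecs (suc m)) G
    ≡⟨ ∑-cong (allBoolVecs (suc m)) (λ c → ∑-allRelations-suc n m (F ∘ prependColumn c)) ⟨
  ∑[ c ∈ allBoolVecs (suc m) ] ∑[ R ∈ allRelations n (suc m) ] F (prependColumn c R)
    ∎
  where
  G : Vec Bool (suc m) → ℕ
  G c = ∑[ R ∈ allRelations n m ] ∑[ v ∈ allBoolVecs n ] F (prependColumn c (v ∷ R))

blockWeight : (ℕ → ℕ) → Vec (Vec Bool n) n → ℕ
blockWeight g R = if isEquivalence R then g (blockCount R) else 0

partitionSum : ℕ → (ℕ → ℕ) → ℕ
partitionSum n g = ∑ (allRelations n n) (blockWeight g)

∑-firstRow : ∀ (g : ℕ → ℕ) (c : Vec Bool n) R →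
  ∑[ row ∈ allBoolVecs (suc n) ] blockWeight g (row ∷ prependColumn c R) ≡ blockWeight g (extend c R)
∑-firstRow {n} g c R = ∑-allBoolVecs-supported (suc n) _ (true ∷ c) off
  where
  off : ∀ row → row ≢ true ∷ c → blockWeight g (row ∷ prependColumn c R) ≡ 0
  off (b ∷ v) row≢ with isEquivalence ((b ∷ v) ∷ prependColumn c R) in eq
  ... | false = refl
  ... | true  = contradiction (cong₂ _∷_ (bordered-corner E) (lookup-ext v c (bordered-row≗column E))) row≢
    where
    E : IsEquivalenceᵇ (bordered b (lookup v) (lookup c) (rel R))
    E = IsEquivalenceᵇ-cong (rel-bordered b v c R) (isEquivalence-sound ((b ∷ v) ∷ prependColumn c R) eq)

closedᵇ-empty : ∀ R (c : Vec Bool n) → nonempty c ≡ false → closedᵇ R c ≡ true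
closedᵇ-empty R c c-empty = closedᵇ-complete R c λ j _ cj → contradiction (trans (sym cj) (nonempty-false⇒ c c-empty j)) λ ()

∑-if-nonempty : ∀ n x → ∑[ c ∈ allBoolVecs n ] (if nonempty c then 0 else x) ≡ x
∑-if-nonempty n x = trans (∑-allBoolVecs-supported n _ (replicate n false) off)
                          (cong (λ b → if b then 0 else x) (nonempty-replicate n))
  where
  off : ∀ c → c ≢ replicate n false → (if nonempty c then 0 else x) ≡ 0
  off c c≢∅ with nonempty c in c-nonempty
  ... | true  = refl
  ... | false = contradiction (nonempty-false⇒≡replicate c c-nonempty) c≢∅

blockWeight-extend : ∀ (g : ℕ → ℕ) (c : Vec Bool n) R → isEquivalence R ≡ true →
  blockWeight g (extend c R) ≡ (if nonempty c then 0 else g (suc (blockCount R))) + g (blockCount R) * isBlock R c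
blockWeight-extend g c R R-equiv rewrite isEquivalence-extend c R | R-equiv
  with closedᵇ R c in closed | nonempty c in c-nonempty
... | false | false = contradiction (trans (sym closed) (closedᵇ-empty R c c-nonempty)) λ ()
... | false | true  = sym (*-zeroʳ (g (blockCount R)))
... | true  | true  = trans (cong g (blockCount-extend c R (closedᵇ-sound R c closed) c-nonempty))
                            (sym (*-identityʳ (g (blockCount R))))
... | true  | false = trans (cong g (blockCount-extend c R (closedᵇ-sound R c closed) c-nonempty))
                            (sym (trans (cong (g (suc (blockCount R)) +_) (*-zeroʳ (g (blockCount R)))) (+-identityʳ _)))

∑-extend : ∀ (g : ℕ → ℕ) (R : Vec (Vec Bool n) n) →
  ∑[ c ∈ allBoolVecs n ] blockWeight g (extend c R) ≡ blockWeight (D g) R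
∑-extend {n} g R with isEquivalence R in R-equiv
... | false = ∑-zero (allBoolVecs n) _ λ c →
  cong (λ b → if b then g (blockCount (extend c R)) else 0)
       (trans (isEquivalence-extend c R) (cong (_∧ closedᵇ R c) R-equiv))
... | true  = begin
  ∑[ c ∈ allBoolVecs n ] blockWeight g (extend c R)
    ≡⟨ ∑-cong (allBoolVecs n) (λ c → blockWeight-extend g c R R-equiv) ⟩
  ∑[ c ∈ allBoolVecs n ] ((if nonempty c then 0 else g (suc k)) + g k * isBlock R c)
    ≡⟨ ∑-+ (allBoolVecs n) _ _ ⟩
  ∑[ c ∈ allBoolVecs n ] (if nonempty c then 0 else g (suc k)) + ∑[ c ∈ allBoolVecs n ] (g k * isBlock R c)
    ≡⟨ cong₂ _+_ (∑-if-nonempty n (g (suc k))) (∑-*ˡ (allBoolVecs n) (g k) (isBlock R)) ⟩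
  g (suc k) + g k * k
    ≡⟨ cong (g (suc k) +_) (*-comm (g k) k) ⟩
  D g k
    ∎
  where
  k : ℕ
  k = blockCount R

partitionSum-suc : ∀ n g → partitionSum (suc n) g ≡ partitionSum n (D g)
partitionSum-suc n g = begin
  ∑ (allRelations (suc n) (suc n)) (blockWeight g)
    ≡⟨ ∑-allRelations-suc (suc n) n _ ⟩
  ∑[ rows ∈ allRelations (suc n) n ] ∑[ row ∈ allBoolVecs (suc n) ] blockWeight g (row ∷ rows)
    ≡⟨ ∑-allRelations-byFirstColumn n n _ ⟩
  ∑[ c ∈ allBoolVecs n ] ∑[ R ∈ allRelations n n ] ∑[ row ∈ allBoolVecs (suc n) ] blockWeight g (row ∷ prependColumn c R)
    ≡⟨ ∑-cong (allBoolVecs n) (λ c → ∑-cong (allRelations n n) (∑-firstRow g c)) ⟩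
  ∑[ c ∈ allBoolVecs n ] ∑[ R ∈ allRelations n n ] blockWeight g (extend c R)
    ≡⟨ ∑-comm (allBoolVecs n) (allRelations n n) _ ⟩
  ∑[ R ∈ allRelations n n ] ∑[ c ∈ allBoolVecs n ] blockWeight g (extend c R)
    ≡⟨ ∑-cong (allRelations n n) (∑-extend g) ⟩
  ∑ (allRelations n n) (blockWeight (D g))
    ∎

partitionSum≡Dⁿ : ∀ n g → partitionSum n g ≡ Dⁿ n g 0
partitionSum≡Dⁿ zero    g = +-identityʳ (g 0)
partitionSum≡Dⁿ (suc n) g = trans (partitionSum-suc n g) (partitionSum≡Dⁿ n (D g))

bell≡bellᴰ : ∀ n → bell n ≡ bellᴰ n
bell≡bellᴰ n = trans (length-filter-T? isEquivalence (allRelations n n)) (partitionSum≡Dⁿ n (const 1))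

mainTheorem7 : (n : ℕ) → 1 ≤ n →
    bell n ≡ sum (map (weight n) (allBoolVecs (n ∸ 1)))
mainTheorem7 (suc m) _ = begin
  bell (suc m)    ≡⟨ bell≡bellᴰ (suc m) ⟩
  bellᴰ (suc m)   ≡⟨ convolution-recurrence-unique _C_ {bellᴰ} {codeSum} refl bellᴰ-recurrence codeSum-recurrence (suc m) ⟩
  codeSum (suc m) ∎
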